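{- For every $n\ge 1$, $|\mathcal{DRS}_n(312,231)|=F_{n+1}$.
   Context: For $\sigma\in\mathfrak{S}_n$, a double descent is an index $i$ with $\sigma_i>\sigma_{i+1}>\sigma_{i+2}$. The permutation $\sigma$ is simsun if for every $k$, the subword of $\sigma$ consisting of the letters in $\{1,\dots,k\}$ (in the order they appear in $\sigma$) has no double descent. For $\omega\in\mathfrak{S}_t$, $\sigma$ contains an $\omega$-pattern if there are indices $i_1<\cdots<i_t$ with $\sigma_{i_j}<\sigma_{i_k}$ iff $\omega_j<\omega_k$; otherwise $\sigma$ avoids $\omega$. $\mathcal{DRS}_n(312,231)$ is the set of $\sigma\in\mathfrak{S}_n$ that avoid both $312$ and $231$, are simsun, and whose inverse is simsun. $F_n$ is the Fibonacci number with $F_1=F_2=1$, $F_n=F_{n-1}+F_{n-2}$. -}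

module Defs where

open import Data.Nat using (ℕ; zero; suc; _+_; _≤_; _>_; _≤?_; _<?_)
open import Data.Fin using (Fin; toℕ) renaming (_<_ to _<ᶠ_; _<?_ to _<ᶠ?_)
open import Data.Fin.Properties using (any?; all?) renaming (_≟_ to _≟ᶠ_)
open import Data.Vec using (Vec; lookup; tabulate; toList; []; _∷_)
open import Data.List using (List; []; _∷_; [_]; map; filter; concatMap; length)
open import Data.List.Membership.Propositional using (_∈_)
open import Data.Product using (∃; ∃-syntax; _×_; _,_)
open import Relation.Nullary using (¬_; Dec; yes; no)
open import Relation.Nullary.Decidable using (¬?; _×-dec_; _→-dec_)
open import Relation.Binary.PropositionalEquality using (_≡_)

F : ℕ → ℕ
F zero = zero
F (suc zero) = suc zero
F (suc (suc n)) = F (suc n) + F n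

-- A permutation of [n] is represented in one-line notation as a vector
-- σ = σ₁ … σₙ of letters in Fin n (letter j : Fin n stands for the value toℕ j + 1).
Word : ℕ → Set
Word n = Vec (Fin n) n

IsPerm : ∀ {n} → Word n → Set
IsPerm {n} σ = ∀ (i j : Fin n) → lookup σ i ≡ lookup σ j → i ≡ j

Contains312 : ∀ {n} → Word n → Set
Contains312 {n} σ = ∃[ i ] ∃[ j ] ∃[ k ]
  (i <ᶠ j × j <ᶠ k × lookup σ j <ᶠ lookup σ k × lookup σ k <ᶠ lookup σ i)

Contains231 : ∀ {n} → Word n → Set
Contains231 {n} σ = ∃[ i ] ∃[ j ] ∃[ k ]
  (i <ᶠ j × j <ᶠ k × lookup σ k <ᶠ lookup σ i × lookup σ i <ᶠ lookup σ j)

data HasDoubleDescent : List ℕ → Set where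
  here  : ∀ {a b c xs} → a > b → b > c → HasDoubleDescent (a ∷ b ∷ c ∷ xs)
  there : ∀ {x xs} → HasDoubleDescent xs → HasDoubleDescent (x ∷ xs)

restrict : ∀ {n} → ℕ → Word n → List ℕ
restrict k σ = filter (λ v → v ≤? k) (map (λ x → suc (toN x)) (toList σ))
  where toN = toℕ

-- σ is simsun: for every k (k = 0,…,n suffices, larger k give the whole word),
-- the restriction of σ to {1,…,k} has no double descent.
IsSimsun : ∀ {n} → Word n → Set
IsSimsun {n} σ = ∀ (k : Fin (suc n)) → ¬ HasDoubleDescent (restrict (toℕ k) σ)

-- Inverse of a word: position of the letter v (for a permutation this is σ⁻¹;
-- for a non-injective word it is some arbitrary but fixed function).
inverse : ∀ {n} → Word n → Word n
inverse {n} σ = tabulate pos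
  where
  pos : Fin n → Fin n
  pos v with any? (λ i → lookup σ i ≟ᶠ v)
  ... | yes (i , _) = i
  ... | no _ = v

IsDRS-312-231 : ∀ {n} → Word n → Set
IsDRS-312-231 σ = IsPerm σ × ¬ Contains312 σ × ¬ Contains231 σ
                  × IsSimsun σ × IsSimsun (inverse σ)

hasDD? : ∀ w → Dec (HasDoubleDescent w)
hasDD? [] = no λ ()
hasDD? (x ∷ []) = no λ { (there ()) }
hasDD? (x ∷ y ∷ []) = no λ { (there (there ())) }
hasDD? (a ∷ b ∷ c ∷ xs) with b <? a | c <? b | hasDD? (b ∷ c ∷ xs)
... | yes p | yes q | _ = yes (here p q)
... | _ | _ | yes r = yes (there r)
... | no ¬p | _ | no ¬r = no λ { (here p q) → ¬p p ; (there r) → ¬r r }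
... | yes _ | no ¬q | no ¬r = no λ { (here p q) → ¬q q ; (there r) → ¬r r }

isDRS? : ∀ {n} (σ : Word n) → Dec (IsDRS-312-231 σ)
isDRS? σ =
  perm? ×-dec (¬? c312?) ×-dec (¬? c231?) ×-dec simsun? σ ×-dec simsun? (inverse σ)
  where
  perm? = all? λ i → all? λ j → (lookup σ i ≟ᶠ lookup σ j) →-dec (i ≟ᶠ j)
  c312? = any? λ i → any? λ j → any? λ k →
    (i <ᶠ? j) ×-dec (j <ᶠ? k) ×-dec (lookup σ j <ᶠ? lookup σ k) ×-dec (lookup σ k <ᶠ? lookup σ i)
  c231? = any? λ i → any? λ j → any? λ k →
    (i <ᶠ? j) ×-dec (j <ᶠ? k) ×-dec (lookup σ k <ᶠ? lookup σ i) ×-dec (lookup σ i <ᶠ? lookup σ j)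
  simsun? : ∀ τ → Dec (IsSimsun τ)
  simsun? τ = all? λ k → ¬? (hasDD? (restrict (toℕ k) τ))

allWords : ∀ n m → List (Vec (Fin n) m)
allWords n zero = [ [] ]
allWords n (suc m) = concatMap (λ x → map (x ∷_) (allWords n m)) (Data.List.allFin n)
  where import Data.List

countDRS : ℕ → ℕ
countDRS n = length (filter isDRS? (allWords n n))

module Submission where

-- A permutation lies in DRS_n(312,231) exactly when it is a product of disjoint adjacent
-- transpositions: its one-line word reads 1, 2, 3, … except that some disjoint pairs of
-- consecutive letters are swapped (a "staircase").  Reading such a word from the left, each
-- step uses one letter (fixed point) or two (swap), so they are counted like tilings by
-- monominoes and dominoes, i.e. by Fibonacci numbers.
--
-- Staircase ⇒ DRS: every
-- letter of a staircase, and of its inverse, moves at most one place, so no letter exceeds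
-- a letter two or more places later; this excludes 312, 231 and double descents of every
-- restriction.  DRS ⇒ staircase: 231- and 312-avoidance and the absence of double descents
-- force the first remaining letter to be the least one o, or o+1 immediately followed by o.

open import Defs
open import Data.Nat using (ℕ; zero; suc; _+_; _≤_; _<_; _>_; _≤?_; s≤s; z≤n; s≤s⁻¹)
open import Data.Nat.Properties
  using (_≟_; +-suc; +-identityʳ; ≤-refl; ≤-reflexive; ≤-trans; <-trans; <-irrefl; n≤1+n; m≤n+m; ≤⇒≯; ≤∧≢⇒<; 1+n≢n)
open import Data.Nat.ListAction using (sum)
open import Data.Fin using (Fin; zero; suc; toℕ; fromℕ; fromℕ<; punchOut) renaming (_<_ to _<ᶠ_)
open import Data.Fin.Properties
  using (any?; <⇒≢; suc-injective; toℕ<n; toℕ-injective; toℕ-fromℕ; toℕ-fromℕ<; injective⇒≤; punchOut-injective)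
  renaming (_≟_ to _≟ᶠ_; <-cmp to <ᶠ-cmp; <-irrefl to <ᶠ-irrefl)
open import Data.Vec using (Vec; []; _∷_; lookup; tabulate; toList)
open import Data.Vec.Properties using (lookup∘tabulate)
open import Data.List using (List; []; _∷_; _++_; map; concatMap; filter; length; allFin)
import Data.List as List
open import Data.List.Properties
  using (length-++; filter-++; filter-≐; filter-accept; filter-reject; filter-all; map-tabulate)
open import Data.List.Relation.Unary.All using (All; []; _∷_)
open import Data.List.Relation.Binary.Sublist.Propositional using (_⊆_; []; _∷_; _∷ʳ_; minimum; ⊆-trans)
open import Data.List.Relation.Binary.Sublist.Propositional.Properties using (filter-⊆)
open import Data.Product using (∃; _×_; _,_; proj₁; proj₂)
open import Data.Sum using (_⊎_; inj₁; inj₂)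
open import Data.Empty using (⊥; ⊥-elim)
open import Function using (_∘_)
open import Level using (0ℓ)
open import Relation.Nullary using (¬_; Dec; yes; no)
open import Relation.Nullary.Decidable using (map′; _×-dec_; _⊎-dec_)
open import Relation.Unary using (Pred; Decidable; _≐_)
open import Relation.Binary.Definitions using (tri<; tri≈; tri>)
open import Relation.Binary.PropositionalEquality using (_≡_; _≢_; refl; sym; trans; cong; cong₂; subst; subst₂)
open Relation.Binary.PropositionalEquality.≡-Reasoning

count : {A : Set} {P : Pred A 0ℓ} → Decidable P → List A → ℕ
count P? xs = length (filter P? xs)

module _ {A : Set} {P : Pred A 0ℓ} (P? : Decidable P) where

  count-++ : ∀ xs ys → count P? (xs ++ ys) ≡ count P? xs + count P? ys
  count-++ xs ys = trans (cong length (filter-++ P? xs ys)) (length-++ (filter P? xs))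

  count-concatMap : {B : Set} (f : B → List A) (bs : List B) →
                    count P? (concatMap f bs) ≡ sum (map (count P? ∘ f) bs)
  count-concatMap f []       = refl
  count-concatMap f (b ∷ bs) =
    trans (count-++ (f b) (concatMap f bs)) (cong (count P? (f b) +_) (count-concatMap f bs))

  count-none : (∀ x → ¬ P x) → ∀ xs → count P? xs ≡ 0
  count-none ¬P []       = refl
  count-none ¬P (x ∷ xs) = trans (cong length (filter-reject P? (¬P x))) (count-none ¬P xs)

  count-map : {B : Set} (f : B → A) (bs : List B) → count P? (map f bs) ≡ count (P? ∘ f) bs
  count-map f [] = refl
  count-map f (b ∷ bs) with P? (f b)
  ... | yes _ = cong suc (count-map f bs)
  ... | no  _ = count-map f bs

module _ {A : Set} {P Q : Pred A 0ℓ} (P? : Decidable P) (Q? : Decidable Q) where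

  count-≐ : P ≐ Q → ∀ xs → count P? xs ≡ count Q? xs
  count-≐ P≐Q xs = cong length (filter-≐ P? Q? P≐Q xs)

  count-⊎ : (∀ x → P x → Q x → ⊥) → ∀ xs → count (λ x → P? x ⊎-dec Q? x) xs ≡ count P? xs + count Q? xs
  count-⊎ disj [] = refl
  count-⊎ disj (x ∷ xs) with P? x | Q? x
  ... | yes p | yes q = ⊥-elim (disj x p q)
  ... | yes _ | no  _ = cong suc (count-⊎ disj xs)
  ... | no  _ | yes _ = trans (cong suc (count-⊎ disj xs)) (sym (+-suc _ _))
  ... | no  _ | no  _ = count-⊎ disj xs

sum-single : ∀ {n} (h : Fin n → ℕ) (c : Fin n) → (∀ x → x ≢ c → h x ≡ 0) → sum (List.tabulate h) ≡ h c
sum-single h zero    vanish =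
  trans (cong (h zero +_) (sum-zero (h ∘ suc) (λ x → vanish (suc x) λ ()))) (+-identityʳ (h zero))
  where
  sum-zero : ∀ {k} (g : Fin k → ℕ) → (∀ x → g x ≡ 0) → sum (List.tabulate g) ≡ 0
  sum-zero {zero}  g z = refl
  sum-zero {suc k} g z rewrite z zero = sum-zero (g ∘ suc) (z ∘ suc)
sum-single h (suc c) vanish rewrite vanish zero (λ ()) =
  sum-single (h ∘ suc) c (λ x x≢c → vanish (suc x) (x≢c ∘ suc-injective))

-- A vector given as a tabulation has the tabulated entries.  Used with `refl`, it lets
-- unification recover the (local) tabulating function of `inverse`.
lookup-tabulated : ∀ {k} {A : Set} (xs : Vec A k) (f : Fin k → A) → xs ≡ tabulate f → ∀ i → lookup xs i ≡ f i
lookup-tabulated _ f refl i = lookup∘tabulate f i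

injective⇒surjective : ∀ {n} (f : Fin n → Fin n) → (∀ i j → f i ≡ f j → i ≡ j) → ∀ y → ∃ λ i → f i ≡ y
injective⇒surjective {suc n} f inj y with any? (λ i → f i ≟ᶠ y)
... | yes hit = hit
... | no miss = ⊥-elim (<-irrefl refl (injective⇒≤ {f = squeeze} squeeze-injective))
  where
  -- without y in its image, f would inject Fin (1+n) into Fin n
  avoids : ∀ i → y ≢ f i
  avoids i y≡fi = miss (i , sym y≡fi)
  squeeze : Fin (suc n) → Fin n
  squeeze i = punchOut (avoids i)
  squeeze-injective : ∀ {i j} → squeeze i ≡ squeeze j → i ≡ j
  squeeze-injective {i} {j} e = inj i j (punchOut-injective (avoids i) (avoids j) e)

module _ {n : ℕ} where

  -- Counting words of length m+1 whose first letter is forced to be c reduces to counting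
  -- words of length m: in the enumeration of `allWords`, only the block starting with c counts.
  count-head : ∀ {m} {P : Pred (Vec (Fin n) (suc m)) 0ℓ} (P? : Decidable P) (c : Fin n) →
               (∀ {x w} → P (x ∷ w) → x ≡ c) →
               count P? (allWords n (suc m)) ≡ count (λ w → P? (c ∷ w)) (allWords n m)
  count-head {m} P? c forced = begin
    count P? (allWords n (suc m))             ≡⟨ count-concatMap P? extend (allFin n) ⟩
    sum (map (count P? ∘ extend) (allFin n))  ≡⟨ cong sum (map-tabulate (λ x → x) (count P? ∘ extend)) ⟩
    sum (List.tabulate (count P? ∘ extend))   ≡⟨ sum-single (count P? ∘ extend) c vanish ⟩
    count P? (extend c)                       ≡⟨ count-map P? (c ∷_) (allWords n m) ⟩
    count (λ w → P? (c ∷ w)) (allWords n m)   ∎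
    where
    extend : Fin n → List (Vec (Fin n) (suc m))
    extend x = map (x ∷_) (allWords n m)
    vanish : ∀ x → x ≢ c → count P? (extend x) ≡ 0
    vanish x x≢c = trans (count-map P? (x ∷_) (allWords n m))
                         (count-none (λ w → P? (x ∷ w)) (λ w p → x≢c (forced p)) (allWords n m))

  -- Staircase 0 σ says that σ
  -- is a product of disjoint adjacent transpositions.
  data Staircase : ℕ → ∀ {m} → Vec (Fin n) m → Set where
    []   : ∀ {o} → Staircase o []
    fix  : ∀ {o m x} {w : Vec (Fin n) m} →
           toℕ x ≡ o → Staircase (suc o) w → Staircase o (x ∷ w)
    swap : ∀ {o m x y} {w : Vec (Fin n) m} →
           toℕ x ≡ suc o → toℕ y ≡ o → Staircase (suc (suc o)) w → Staircase o (x ∷ y ∷ w)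

  FixStep : ∀ {m} → ℕ → Vec (Fin n) (suc m) → Set
  FixStep o (x ∷ w) = toℕ x ≡ o × Staircase (suc o) w

  SwapStep : ∀ {m} → ℕ → Vec (Fin n) (suc (suc m)) → Set
  SwapStep o (x ∷ y ∷ w) = toℕ x ≡ suc o × toℕ y ≡ o × Staircase (suc (suc o)) w

  staircase-split : ∀ {m} o (w : Vec (Fin n) (suc (suc m))) → Staircase o w → FixStep o w ⊎ SwapStep o w
  staircase-split o (x ∷ y ∷ w) (fix e s)      = inj₁ (e , s)
  staircase-split o (x ∷ y ∷ w) (swap e e′ s) = inj₂ (e , e′ , s)

  staircase-join : ∀ {m} o (w : Vec (Fin n) (suc (suc m))) → FixStep o w ⊎ SwapStep o w → Staircase o w
  staircase-join o (x ∷ y ∷ w) (inj₁ (e , s))      = fix e s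
  staircase-join o (x ∷ y ∷ w) (inj₂ (e , e′ , s)) = swap e e′ s

  steps-disjoint : ∀ {m} o (w : Vec (Fin n) (suc (suc m))) → FixStep o w → SwapStep o w → ⊥
  steps-disjoint o (x ∷ y ∷ w) (e , _) (e′ , _) with trans (sym e) e′
  ... | ()

  staircase? : ∀ {m} o (w : Vec (Fin n) m) → Dec (Staircase o w)
  fixStep?   : ∀ {m} o (w : Vec (Fin n) (suc m)) → Dec (FixStep o w)
  swapStep?  : ∀ {m} o (w : Vec (Fin n) (suc (suc m))) → Dec (SwapStep o w)

  staircase? o []              = yes []
  staircase? o (x ∷ [])        = map′ (λ (e , s) → fix e s) (λ { (fix e s) → e , s }) (fixStep? o (x ∷ []))
  staircase? o w@(_ ∷ _ ∷ _)   = map′ (staircase-join o w) (staircase-split o w)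
                                      (fixStep? o w ⊎-dec swapStep? o w)
  fixStep? o (x ∷ w)           = (toℕ x ≟ o) ×-dec staircase? (suc o) w
  swapStep? o (x ∷ y ∷ w)      = (toℕ x ≟ suc o) ×-dec (toℕ y ≟ o) ×-dec staircase? (suc (suc o)) w

  swap-first : ∀ {m o x} (w : Vec (Fin n) (suc m)) → SwapStep o (x ∷ w) → toℕ x ≡ suc o
  swap-first (y ∷ w) (e , _) = e

  letter-unique : ∀ {o} (o<n : o < n) {x : Fin n} → toℕ x ≡ o → x ≡ fromℕ< o<n
  letter-unique o<n e = toℕ-injective (trans e (sym (toℕ-fromℕ< o<n)))

  count-fixStep : ∀ {m} o → o < n →
                  count (fixStep? o) (allWords n (suc m)) ≡ count (staircase? (suc o)) (allWords n m)
  count-fixStep {m} o o<n = begin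
    count (fixStep? o) (allWords n (suc m))
      ≡⟨ count-head (fixStep? o) c (λ (e , _) → letter-unique o<n e) ⟩
    count (λ w → fixStep? o (c ∷ w)) (allWords n m)
      ≡⟨ count-≐ (λ w → fixStep? o (c ∷ w)) (staircase? (suc o)) (proj₂ , (toℕ-fromℕ< o<n ,_)) (allWords n m) ⟩
    count (staircase? (suc o)) (allWords n m) ∎
    where c = fromℕ< o<n

  count-swapStep : ∀ {m} o → suc o < n →
                   count (swapStep? o) (allWords n (suc (suc m))) ≡ count (staircase? (suc (suc o))) (allWords n m)
  count-swapStep {m} o so<n = begin
    count (swapStep? o) (allWords n (suc (suc m)))
      ≡⟨ count-head (swapStep? o) c₁ (λ {_} {w} p → letter-unique so<n (swap-first w p)) ⟩
    count (λ w → swapStep? o (c₁ ∷ w)) (allWords n (suc m))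
      ≡⟨ count-head (λ w → swapStep? o (c₁ ∷ w)) c₀ (λ (_ , e , _) → letter-unique o<n e) ⟩
    count (λ w → swapStep? o (c₁ ∷ c₀ ∷ w)) (allWords n m)
      ≡⟨ count-≐ (λ w → swapStep? o (c₁ ∷ c₀ ∷ w)) (staircase? (suc (suc o)))
                 ((λ (_ , _ , s) → s) , (λ s → toℕ-fromℕ< so<n , toℕ-fromℕ< o<n , s)) (allWords n m) ⟩
    count (staircase? (suc (suc o))) (allWords n m) ∎
    where
    o<n = ≤-trans (n≤1+n (suc o)) so<n
    c₀ = fromℕ< o<n
    c₁ = fromℕ< so<n

  -- Staircases of length m from offset o (fitting in the alphabet) are counted by
  -- F (m+1): the first step uses up one letter (fixed point) or two (swap).
  staircase-count : ∀ m o → m + o ≤ n → count (staircase? o) (allWords n m) ≡ F (suc m)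
  staircase-count zero          o _   = refl
  staircase-count (suc zero)    o o<n = begin
    count (staircase? o) (allWords n 1)
      ≡⟨ count-head (staircase? o) c (λ { (fix e _) → letter-unique o<n e }) ⟩
    count (λ w → staircase? o (c ∷ w)) (allWords n 0)
      ≡⟨ cong length (filter-accept (λ w → staircase? o (c ∷ w)) (fix (toℕ-fromℕ< o<n) [])) ⟩
    1 ∎
    where c = fromℕ< o<n
  staircase-count (suc (suc m)) o fits = begin
    count (staircase? o) (allWords n (suc (suc m)))
      ≡⟨ count-≐ (staircase? o) (λ w → fixStep? o w ⊎-dec swapStep? o w)
                 ((λ {w} → staircase-split o w) , (λ {w} → staircase-join o w)) (allWords n (suc (suc m))) ⟩
    count (λ w → fixStep? o w ⊎-dec swapStep? o w) (allWords n (suc (suc m)))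
      ≡⟨ count-⊎ (fixStep? o) (swapStep? o) (steps-disjoint o) (allWords n (suc (suc m))) ⟩
    count (fixStep? o) (allWords n (suc (suc m))) + count (swapStep? o) (allWords n (suc (suc m)))
      ≡⟨ cong₂ _+_ (count-fixStep o o<n) (count-swapStep o so<n) ⟩
    count (staircase? (suc o)) (allWords n (suc m)) + count (staircase? (suc (suc o))) (allWords n m)
      ≡⟨ cong₂ _+_ (staircase-count (suc m) (suc o) fits₁) (staircase-count m (suc (suc o)) fits₂) ⟩
    F (suc (suc m)) + F (suc m) ∎
    where
    fits₂ : m + suc (suc o) ≤ n
    fits₂ = subst (_≤ n) (sym (trans (+-suc m (suc o)) (cong suc (+-suc m o)))) fits
    fits₁ : suc m + suc o ≤ n
    fits₁ = subst (_≤ n) (sym (cong suc (+-suc m o))) fits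
    so<n : suc o < n
    so<n = ≤-trans (s≤s (s≤s (m≤n+m o m))) fits
    o<n : o < n
    o<n = ≤-trans (n≤1+n (suc o)) so<n

  InjectiveWord : ∀ {m} → Vec (Fin n) m → Set
  InjectiveWord {m} w = ∀ (i j : Fin m) → lookup w i ≡ lookup w j → i ≡ j

  Pattern312 : ∀ {m} → Vec (Fin n) m → Set
  Pattern312 {m} w = ∃ λ (i : Fin m) → ∃ λ (j : Fin m) → ∃ λ (k : Fin m) →
    i <ᶠ j × j <ᶠ k × lookup w j <ᶠ lookup w k × lookup w k <ᶠ lookup w i

  Pattern231 : ∀ {m} → Vec (Fin n) m → Set
  Pattern231 {m} w = ∃ λ (i : Fin m) → ∃ λ (j : Fin m) → ∃ λ (k : Fin m) →
    i <ᶠ j × j <ᶠ k × lookup w k <ᶠ lookup w i × lookup w i <ᶠ lookup w j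

  values : ∀ {m} → Vec (Fin n) m → List ℕ
  values w = map (λ x → suc (toℕ x)) (toList w)

  -- A wide inversion: a letter larger than a letter at least two places later.
  -- Both 312 and 231 patterns, and double descents of restrictions, are wide inversions.
  WideInversion : ∀ {m} → Vec (Fin n) m → Set
  WideInversion {m} w = ∃ λ (i : Fin m) → ∃ λ (j : Fin m) → ∃ λ (k : Fin m) →
    i <ᶠ j × j <ᶠ k × lookup w k <ᶠ lookup w i

  descent-sublist : ∀ {L} → HasDoubleDescent L →
                    ∃ λ a → ∃ λ b → ∃ λ c → a > b × b > c × (a ∷ b ∷ c ∷ []) ⊆ L
  descent-sublist (here {xs = xs} a>b b>c) = _ , _ , _ , a>b , b>c , refl ∷ refl ∷ refl ∷ minimum xs
  descent-sublist (there {x = x} dd) with descent-sublist dd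
  ... | a , b , c , a>b , b>c , sub = a , b , c , a>b , b>c , x ∷ʳ sub

  position₁ : ∀ {m c cs} (w : Vec (Fin n) m) → (c ∷ cs) ⊆ values w →
              ∃ λ (k : Fin m) → suc (toℕ (lookup w k)) ≡ c
  position₁ (x ∷ w) (_ ∷ʳ sub) with position₁ w sub
  ... | k , e = suc k , e
  position₁ (x ∷ w) (refl ∷ _) = zero , refl

  position₂ : ∀ {m b c cs} (w : Vec (Fin n) m) → (b ∷ c ∷ cs) ⊆ values w →
              ∃ λ (j : Fin m) → ∃ λ (k : Fin m) → j <ᶠ k × suc (toℕ (lookup w k)) ≡ c
  position₂ (x ∷ w) (_ ∷ʳ sub) with position₂ w sub
  ... | j , k , j<k , e = suc j , suc k , s≤s j<k , e
  position₂ (x ∷ w) (refl ∷ sub) with position₁ w sub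
  ... | k , e = zero , suc k , s≤s z≤n , e

  position₃ : ∀ {m a b c cs} (w : Vec (Fin n) m) → (a ∷ b ∷ c ∷ cs) ⊆ values w →
              ∃ λ (i : Fin m) → ∃ λ (j : Fin m) → ∃ λ (k : Fin m) → i <ᶠ j × j <ᶠ k ×
                suc (toℕ (lookup w i)) ≡ a × suc (toℕ (lookup w k)) ≡ c
  position₃ (x ∷ w) (_ ∷ʳ sub) with position₃ w sub
  ... | i , j , k , i<j , j<k , eᵢ , eₖ = suc i , suc j , suc k , s≤s i<j , s≤s j<k , eᵢ , eₖ
  position₃ (x ∷ w) (refl ∷ sub) with position₂ w sub
  ... | j , k , j<k , e = zero , suc j , suc k , s≤s z≤n , s≤s j<k , refl , e

  descent⇒wide : ∀ {m} k (w : Vec (Fin n) m) →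
                 HasDoubleDescent (filter (λ v → v ≤? k) (values w)) → WideInversion w
  descent⇒wide k w dd with descent-sublist dd
  ... | a , b , c , a>b , b>c , sub
    with position₃ w (⊆-trans sub (filter-⊆ (λ v → v ≤? k) (values w)))
  ... | i , j , l , i<j , j<l , refl , refl = i , j , l , i<j , j<l , s≤s⁻¹ (<-trans b>c a>b)

  simsun-of-noWide : (σ : Word n) → ¬ WideInversion σ → IsSimsun σ
  simsun-of-noWide σ noWide k dd = noWide (descent⇒wide (toℕ k) σ dd)

  Near : ∀ {m} → ℕ → Vec (Fin n) m → Set
  Near {m} o w = ∀ (i : Fin m) → toℕ (lookup w i) ≤ suc (o + toℕ i) × o + toℕ i ≤ suc (toℕ (lookup w i))

  -- A word whose letters move by at most one place has no wide inversion:
  -- w i ≤ i + 1 ≤ j ≤ w k whenever i < j < k.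
  near-noWide : ∀ {m} {w : Vec (Fin n) m} → Near 0 w → ¬ WideInversion w
  near-noWide {w = w} near (i , j , k , i<j , j<k , wk<wi) = ≤⇒≯ wi≤wk wk<wi
    where
    wi≤wk : toℕ (lookup w i) ≤ toℕ (lookup w k)
    wi≤wk = ≤-trans (proj₁ (near i)) (≤-trans i<j (s≤s⁻¹ (≤-trans j<k (proj₂ (near k)))))

  staircase-near : ∀ {m o} {w : Vec (Fin n) m} → Staircase o w → Near o w
  staircase-near {o = o} (fix e s) zero rewrite e | +-identityʳ o = n≤1+n o , n≤1+n o
  staircase-near {o = o} (fix e s) (suc i) rewrite +-suc o (toℕ i) = staircase-near s i
  staircase-near {o = o} (swap e e′ s) zero rewrite e | +-identityʳ o = ≤-refl , m≤n+m o 2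
  staircase-near {o = o} (swap e e′ s) (suc zero) rewrite e′ | +-suc o 0 | +-identityʳ o = m≤n+m o 2 , ≤-refl
  staircase-near {o = o} (swap e e′ s) (suc (suc i))
    rewrite +-suc o (suc (toℕ i)) | +-suc o (toℕ i) = staircase-near s i

  staircase-above : ∀ {m o} {w : Vec (Fin n) m} → Staircase o w → ∀ i → o ≤ toℕ (lookup w i)
  staircase-above (fix e s) zero = ≤-reflexive (sym e)
  staircase-above {o = o} (fix e s) (suc i) = ≤-trans (n≤1+n o) (staircase-above s i)
  staircase-above {o = o} (swap e e′ s) zero = ≤-trans (n≤1+n o) (≤-reflexive (sym e))
  staircase-above (swap e e′ s) (suc zero) = ≤-reflexive (sym e′)
  staircase-above {o = o} (swap e e′ s) (suc (suc i)) = ≤-trans (m≤n+m o 2) (staircase-above s i)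

  injective-cons : ∀ {m x} {w : Vec (Fin n) m} → (∀ j → lookup w j ≢ x) →
                   InjectiveWord w → InjectiveWord (x ∷ w)
  injective-cons fresh inj zero    zero    _ = refl
  injective-cons fresh inj zero    (suc j) e = ⊥-elim (fresh j (sym e))
  injective-cons fresh inj (suc i) zero    e = ⊥-elim (fresh i e)
  injective-cons fresh inj (suc i) (suc j) e = cong suc (inj i j e)

  staircase-fresh : ∀ {m o x} {w : Vec (Fin n) m} → Staircase o w → toℕ x < o → ∀ j → lookup w j ≢ x
  staircase-fresh s x<o j refl = ≤⇒≯ (staircase-above s j) x<o

  staircase-injective : ∀ {m o} {w : Vec (Fin n) m} → Staircase o w → InjectiveWord w
  staircase-injective [] ()
  staircase-injective {o = o} (fix e s) =
    injective-cons (staircase-fresh s (subst (_< suc o) (sym e) ≤-refl)) (staircase-injective s)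
  staircase-injective {o = o} (swap {x = x} {y} e e′ s) =
    injective-cons fresh-x (injective-cons (staircase-fresh s y<o+2) (staircase-injective s))
    where
    y<o+2 : toℕ y < suc (suc o)
    y<o+2 = subst (_< suc (suc o)) (sym e′) (n≤1+n (suc o))
    fresh-x : ∀ j → lookup (y ∷ _) j ≢ x
    fresh-x zero    y≡x = <⇒≢ (subst₂ _<_ (sym e′) (sym e) ≤-refl) y≡x
    fresh-x (suc j) = staircase-fresh s (subst (_< suc (suc o)) (sym e) ≤-refl) j

  inverse-cases : (σ : Word n) (v : Fin n) (P : Fin n → Set) →
                  (∀ i → lookup σ i ≡ v → P i) → P v → P (lookup (inverse σ) v)
  inverse-cases σ v P found missing rewrite lookup-tabulated (inverse σ) _ refl v
    with any? (λ i → lookup σ i ≟ᶠ v)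
  ... | yes (i , σi≡v) = found i σi≡v
  ... | no _           = missing

  -- Nearness is symmetric in letters and positions, hence passes to the inverse.
  near-inverse : (σ : Word n) → Near 0 σ → Near 0 (inverse σ)
  near-inverse σ near v = inverse-cases σ v (λ t → toℕ t ≤ suc (toℕ v) × toℕ v ≤ suc (toℕ t))
    (λ { i refl → proj₂ (near i) , proj₁ (near i) })
    (n≤1+n (toℕ v) , n≤1+n (toℕ v))

  staircase⇒DRS : (σ : Word n) → Staircase 0 σ → IsDRS-312-231 σ
  staircase⇒DRS σ s =
      staircase-injective s
    , (λ (i , j , k , i<j , j<k , _ , σk<σi) → near-noWide {w = σ} near (i , j , k , i<j , j<k , σk<σi))
    , (λ (i , j , k , i<j , j<k , σk<σi , _) → near-noWide {w = σ} near (i , j , k , i<j , j<k , σk<σi))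
    , simsun-of-noWide σ (near-noWide {w = σ} near)
    , simsun-of-noWide (inverse σ) (near-noWide {w = inverse σ} (near-inverse σ near))
    where
    near : Near 0 σ
    near = staircase-near s

  smaller-before-smaller : ∀ {m x} {v : Vec (Fin n) m} → InjectiveWord (x ∷ v) → ¬ Pattern231 (x ∷ v) →
                           ∀ {j k} → j <ᶠ k → lookup v k <ᶠ x → lookup v j <ᶠ x
  smaller-before-smaller {x = x} {v} inj no231 {j} {k} j<k vk<x with <ᶠ-cmp (lookup v j) x
  ... | tri< vj<x _ _ = vj<x
  ... | tri≈ _ vj≡x _ with inj (suc j) zero vj≡x
  ...   | ()
  smaller-before-smaller {x = x} {v} inj no231 {j} {k} j<k vk<x | tri> _ _ x<vj =
    ⊥-elim (no231 (zero , suc j , suc k , s≤s z≤n , s≤s j<k , vk<x , x<vj))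

  -- Two letters right after x and both smaller than x form a 312 pattern with x
  -- (if increasing) or a double descent (if decreasing).
  two-smaller : ∀ {m x y z} {v : Vec (Fin n) m} → InjectiveWord (x ∷ y ∷ z ∷ v) →
                ¬ Pattern312 (x ∷ y ∷ z ∷ v) → ¬ HasDoubleDescent (values (x ∷ y ∷ z ∷ v)) →
                y <ᶠ x → z <ᶠ x → ⊥
  two-smaller {y = y} {z} inj no312 noDescent y<x z<x with <ᶠ-cmp y z
  ... | tri< y<z _ _ = no312 (zero , suc zero , suc (suc zero) , s≤s z≤n , s≤s (s≤s z≤n) , y<z , z<x)
  ... | tri≈ _ y≡z _ with inj (suc zero) (suc (suc zero)) y≡z
  ...   | ()
  two-smaller inj no312 noDescent y<x z<x | tri> _ _ z<y = noDescent (here (s≤s y<x) (s≤s z<y))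

  -- Hence in such a word x ∷ y ∷ v that also avoids 231, no letter of v is smaller than x:
  -- by 231-avoidance, y and the head of v would be smaller than x too.
  no-late-smaller : ∀ {m x y} {v : Vec (Fin n) m} → InjectiveWord (x ∷ y ∷ v) →
                    ¬ Pattern312 (x ∷ y ∷ v) → ¬ Pattern231 (x ∷ y ∷ v) →
                    ¬ HasDoubleDescent (values (x ∷ y ∷ v)) → ∀ q → lookup v q <ᶠ x → ⊥
  no-late-smaller {v = z ∷ v} inj no312 no231 noDescent q vq<x =
    two-smaller inj no312 noDescent y<x (z<x q vq<x)
    where
    y<x = smaller-before-smaller inj no231 {k = suc q} (s≤s z≤n) vq<x
    z<x : ∀ q → lookup (z ∷ v) q <ᶠ _ → z <ᶠ _
    z<x zero    vq<x = vq<x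
    z<x (suc q) vq<x = smaller-before-smaller inj no231 {k = suc (suc q)} (s≤s (s≤s z≤n)) vq<x

  smaller-is-second : ∀ {m x} {v : Vec (Fin n) m} → InjectiveWord (x ∷ v) →
                      ¬ Pattern312 (x ∷ v) → ¬ Pattern231 (x ∷ v) → ¬ HasDoubleDescent (values (x ∷ v)) →
                      ∀ i → lookup (x ∷ v) i <ᶠ x → toℕ i ≡ 1
  smaller-is-second _ _ _ _ zero x<x = ⊥-elim (<ᶠ-irrefl refl x<x)
  smaller-is-second _ _ _ _ (suc zero) _ = refl
  smaller-is-second {v = _ ∷ _} inj no312 no231 noDescent (suc (suc q)) vq<x =
    ⊥-elim (no-late-smaller inj no312 no231 noDescent q vq<x)

  -- This is what remains of a permutation in
  -- DRS_n(312,231) after an initial segment holding the letters below o.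
  record DRSTail {m} (o : ℕ) (w : Vec (Fin n) m) : Set where
    field
      injective : InjectiveWord w
      above     : ∀ i → o ≤ toℕ (lookup w i)
      covers    : ∀ c → o ≤ c → c < n → ∃ λ i → toℕ (lookup w i) ≡ c
      no312     : ¬ Pattern312 w
      no231     : ¬ Pattern231 w
      noDescent : ¬ HasDoubleDescent (values w)

  module _ {m o x} {v : Vec (Fin n) m} (t : DRSTail o (x ∷ v)) where
    open DRSTail t

    second-letter : ∀ c → o ≤ c → c < toℕ x →
                    ∃ λ (i : Fin (suc m)) → toℕ i ≡ 1 × toℕ (lookup (x ∷ v) i) ≡ c
    second-letter c o≤c c<x with covers c o≤c (≤-trans c<x (≤-trans (n≤1+n (toℕ x)) (toℕ<n x)))
    ... | i , e = i , smaller-is-second injective no312 no231 noDescent i (subst (_< toℕ x) (sym e) c<x) , e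

    -- The first letter is o or o+1: otherwise both o and o+1 would be the second letter.
    first-letter : toℕ x ≡ o ⊎ toℕ x ≡ suc o
    first-letter with toℕ x ≟ o | toℕ x ≟ suc o
    ... | yes x≡o | _        = inj₁ x≡o
    ... | no _    | yes x≡o+1 = inj₂ x≡o+1
    ... | no x≢o  | no x≢o+1  with second-letter o ≤-refl o+1<x | second-letter (suc o) (n≤1+n o) o+2≤x
      where
      o+1<x : suc o ≤ toℕ x
      o+1<x = ≤∧≢⇒< (above zero) (x≢o ∘ sym)
      o+2≤x : suc (suc o) ≤ toℕ x
      o+2≤x = ≤∧≢⇒< o+1<x (x≢o+1 ∘ sym)
    ...   | i , i≡1 , vi≡o | j , j≡1 , vj≡o+1 = ⊥-elim (1+n≢n (begin
      suc o                       ≡⟨ vj≡o+1 ⟨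
      toℕ (lookup (x ∷ v) j)      ≡⟨ cong (λ k → toℕ (lookup (x ∷ v) k)) (toℕ-injective (trans j≡1 (sym i≡1))) ⟩
      toℕ (lookup (x ∷ v) i)      ≡⟨ vi≡o ⟩
      o                           ∎))

  injective-tail : ∀ {m x} {v : Vec (Fin n) m} → InjectiveWord (x ∷ v) → InjectiveWord v
  injective-tail inj i j e = suc-injective (inj (suc i) (suc j) e)

  no312-tail : ∀ {m x} {v : Vec (Fin n) m} → ¬ Pattern312 (x ∷ v) → ¬ Pattern312 v
  no312-tail no312 (i , j , k , i<j , j<k , p , q) = no312 (suc i , suc j , suc k , s≤s i<j , s≤s j<k , p , q)

  no231-tail : ∀ {m x} {v : Vec (Fin n) m} → ¬ Pattern231 (x ∷ v) → ¬ Pattern231 v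
  no231-tail no231 (i , j , k , i<j , j<k , p , q) = no231 (suc i , suc j , suc k , s≤s i<j , s≤s j<k , p , q)

  noDescent-tail : ∀ {m x} {v : Vec (Fin n) m} →
                   ¬ HasDoubleDescent (values (x ∷ v)) → ¬ HasDoubleDescent (values v)
  noDescent-tail noDescent dd = noDescent (there dd)

  values-distinct : ∀ {m} {w : Vec (Fin n) m} → InjectiveWord w → ∀ {i j} → i ≢ j →
                    toℕ (lookup w i) ≢ toℕ (lookup w j)
  values-distinct inj i≢j e = i≢j (inj _ _ (toℕ-injective e))

  covers-tail : ∀ {m o o′ x} {v : Vec (Fin n) m} →
                (∀ c → o ≤ c → c < n → ∃ λ i → toℕ (lookup (x ∷ v) i) ≡ c) → o ≤ o′ → toℕ x < o′ →
                ∀ c → o′ ≤ c → c < n → ∃ λ i → toℕ (lookup v i) ≡ c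
  covers-tail covers o≤o′ x<o′ c o′≤c c<n with covers c (≤-trans o≤o′ o′≤c) c<n
  ... | zero  , x≡c = ⊥-elim (≤⇒≯ o′≤c (subst (_< _) x≡c x<o′))
  ... | suc i , vi≡c = i , vi≡c

  drop-fixed : ∀ {m o x} {v : Vec (Fin n) m} → DRSTail o (x ∷ v) → toℕ x ≡ o → DRSTail (suc o) v
  drop-fixed {o = o} {x} {v} t x≡o = record
    { injective = injective-tail injective
    ; above     = λ i → ≤∧≢⇒< (above (suc i)) (not-o i)
    ; covers    = covers-tail covers (n≤1+n o) (subst (_< suc o) (sym x≡o) ≤-refl)
    ; no312     = no312-tail no312
    ; no231     = no231-tail no231
    ; noDescent = noDescent-tail noDescent
    }
    where
    open DRSTail t
    -- the letter o sits at position 0, so not in v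
    not-o : ∀ i → o ≢ toℕ (lookup v i)
    not-o i o≡vi = values-distinct {w = x ∷ v} injective {zero} {suc i} (λ ()) (trans x≡o o≡vi)

  drop-swapped : ∀ {m o x y} {v : Vec (Fin n) m} → DRSTail o (x ∷ y ∷ v) → toℕ x ≡ suc o → toℕ y ≡ o →
                 DRSTail (suc (suc o)) v
  drop-swapped {o = o} {x} {y} {v} t x≡o+1 y≡o = record
    { injective = injective-tail (injective-tail injective)
    ; above     = λ i → ≤∧≢⇒< (≤∧≢⇒< (above (suc (suc i))) (not-o i)) (not-o+1 i)
    ; covers    = covers-tail (covers-tail covers (m≤n+m o 2) (subst (_< suc (suc o)) (sym x≡o+1) ≤-refl))
                              ≤-refl (subst (_< suc (suc o)) (sym y≡o) (n≤1+n (suc o)))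
    ; no312     = no312-tail (no312-tail no312)
    ; no231     = no231-tail (no231-tail no231)
    ; noDescent = noDescent-tail (noDescent-tail noDescent)
    }
    where
    open DRSTail t
    -- the letters o+1 and o sit at positions 0 and 1, so not in v
    not-o : ∀ i → o ≢ toℕ (lookup v i)
    not-o i o≡vi =
      values-distinct {w = x ∷ y ∷ v} injective {suc zero} {suc (suc i)} (λ ()) (trans y≡o o≡vi)
    not-o+1 : ∀ i → suc o ≢ toℕ (lookup v i)
    not-o+1 i o+1≡vi =
      values-distinct {w = x ∷ y ∷ v} injective {zero} {suc (suc i)} (λ ()) (trans x≡o+1 o+1≡vi)

  -- Every DRS tail from o is a staircase from o: its first letter is o (a fixed point),
  -- or o+1 followed by o (a swapped pair), and the rest is again a DRS tail.
  drsTail⇒staircase : ∀ {m} o (w : Vec (Fin n) m) → DRSTail o w → Staircase o w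
  drsTail⇒staircase o []      t = []
  drsTail⇒staircase o (x ∷ v) t with first-letter t
  ... | inj₁ x≡o   = fix x≡o (drsTail⇒staircase (suc o) v (drop-fixed t x≡o))
  ... | inj₂ x≡o+1 with second-letter t o ≤-refl (subst (o <_) (sym x≡o+1) ≤-refl)
  drsTail⇒staircase o (x ∷ y ∷ v) t | inj₂ x≡o+1 | suc zero , _ , y≡o =
    swap x≡o+1 y≡o (drsTail⇒staircase (suc (suc o)) v (drop-swapped t x≡o+1 y≡o))

  values-bounded : ∀ {m} (w : Vec (Fin n) m) → All (_≤ n) (values w)
  values-bounded []      = []
  values-bounded (x ∷ w) = toℕ<n x ∷ values-bounded w

  -- Restricting to all of {1,…,n} keeps the whole word, so a simsun word has no double descent.
  simsun⇒noDescent : (σ : Word n) → IsSimsun σ → ¬ HasDoubleDescent (values σ)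
  simsun⇒noDescent σ simsun dd = simsun (fromℕ n) (subst HasDoubleDescent (sym whole) dd)
    where
    whole : restrict (toℕ (fromℕ n)) σ ≡ values σ
    whole rewrite toℕ-fromℕ n = filter-all (λ v → v ≤? n) (values-bounded σ)

  DRS⇒staircase : (σ : Word n) → IsDRS-312-231 σ → Staircase 0 σ
  DRS⇒staircase σ (perm , no312 , no231 , simsun , _) = drsTail⇒staircase 0 σ record
    { injective = perm
    ; above     = λ _ → z≤n
    ; covers    = λ c _ c<n → let (i , σi≡c) = injective⇒surjective (lookup σ) perm (fromℕ< c<n)
                              in i , trans (cong toℕ σi≡c) (toℕ-fromℕ< c<n)
    ; no312     = no312
    ; no231     = no231
    ; noDescent = simsun⇒noDescent σ simsun
    }

corollary4p10 : ∀ (n : ℕ) → 1 ≤ n → countDRS n ≡ F (suc n)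
corollary4p10 n _ = begin
  countDRS n                           ≡⟨⟩
  count isDRS? (allWords n n)          ≡⟨ count-≐ isDRS? (staircase? 0) DRS≐staircase (allWords n n) ⟩
  count (staircase? 0) (allWords n n)  ≡⟨ staircase-count n 0 (≤-reflexive (+-identityʳ n)) ⟩
  F (suc n)                            ∎
  where
  DRS≐staircase : IsDRS-312-231 ≐ Staircase 0
  DRS≐staircase = (λ {σ} → DRS⇒staircase σ) , (λ {σ} → staircase⇒DRS σ)
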